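{- Let $p$ be a prime and $n$ a positive integer, and let $b>1$ be an integer. If $N=p^n$ has a palindromic base-$b$ representation $N=(c_k,c_{k-1},\ldots,c_0)_b$ with $k$ odd, then $b=p^x-1$ for some integer $x$.
   Context: For an integer $b>1$, every positive integer $N$ can be written uniquely as $N=\sum_{i=0}^k c_i b^i$ with integers $0\le c_i<b$ and $c_k>0$; this is written $N=(c_k,\ldots,c_0)_b$. It is palindromic if $c_j=c_{k-j}$ for all $j=0,\ldots,k$. -}

module Defs where

open import Data.Nat using (ℕ; zero; suc; _+_; _*_; _^_; _<_)
open import Data.Vec using (Vec; []; _∷_; lookup; reverse)
open import Data.Fin using (Fin; fromℕ)
open import Data.Product using (_×_)
open import Data.Vec.Relation.Unary.All using (All)
open import Relation.Binary.PropositionalEquality using (_≡_)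

-- Value of a little-endian digit vector (c₀, c₁, …, c_k) in base b:
-- c₀ + b * (c₁ + b * (…)) = Σ c_i b^i.
value : ∀ {m} → ℕ → Vec ℕ m → ℕ
value b []       = 0
value b (c ∷ cs) = c + b * value b cs

IsBaseRep : (b N k : ℕ) → Vec ℕ (suc k) → Set
IsBaseRep b N k cs =
  All (λ c → c < b) cs × 0 < lookup cs (fromℕ k) × value b cs ≡ N

IsPalindrome : ∀ {m} → Vec ℕ m → Set
IsPalindrome cs = reverse cs ≡ cs

{-# OPTIONS --safe #-}

-- Since b ≡ -1 modulo b + 1, a number is congruent modulo b + 1 to the alternating
-- sum of its digits.  Reversing a digit string of even length negates that sum, so
-- for an even-length palindrome it vanishes and b + 1 divides N = p ^ n; the only
-- divisors of a prime power are powers of the same prime.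

module Submission where

open import Defs
open import Data.Nat using (ℕ; suc; _^_; _∸_; _<_; _*_)
open import Data.Nat.Primality using (Prime)
open import Data.Vec using (Vec)
open import Data.Product using (∃-syntax)
open import Relation.Binary.PropositionalEquality using (_≡_)

open import Data.Nat as ℕ using (zero)
import Data.Nat.Properties as ℕ
open import Data.Nat.Divisibility as ℕ using (divides; _∣?_; _∤_; ∣1⇒≡1)
open import Data.Nat.Coprimality using (Coprime; coprime-divisor)
open import Data.Nat.Primality using (prime⇒irreducible; prime⇒nonZero)
open import Data.Integer as ℤ using (ℤ; +_; -_; 0ℤ; 1ℤ; -1ℤ; +[1+_]; -[1+_])
import Data.Integer.Properties as ℤ
open import Data.Integer.Divisibility.Signed as ℤ
  using (∣-refl; ∣m∣n⇒∣m+n; ∣n⇒∣m*n; ∣m⇒∣m*n; ∣⇒∣ᵤ; module ∣-Reasoning)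
open import Data.Integer.Tactic.RingSolver using (solve-∀)
open import Data.Vec using ([]; _∷_; reverse; _∷ʳ_)
open import Data.Vec.Properties using (reverse-∷)
open import Data.Product using (_,_; map₂)
open import Data.Sum using (inj₁; inj₂)
open import Relation.Nullary using (yes; no; contradiction)
open import Relation.Binary.PropositionalEquality
  using (refl; sym; trans; cong; subst; module ≡-Reasoning)

prime∤⇒coprime : ∀ {p d} → Prime p → p ∤ d → Coprime d p
prime∤⇒coprime pr p∤d (e∣d , e∣p) with prime⇒irreducible pr e∣p
... | inj₁ e≡1 = e≡1
... | inj₂ refl = contradiction e∣d p∤d

∣p^n⇒≡p^x : ∀ {p d} → Prime p → ∀ n → d ℕ.∣ p ^ n → ∃[ x ] d ≡ p ^ x
∣p^n⇒≡p^x pr zero d∣1 = 0 , ∣1⇒≡1 d∣1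
∣p^n⇒≡p^x {p} {d} pr (suc n) d∣p^[1+n] with p ∣? d
... | no p∤d = ∣p^n⇒≡p^x pr n (coprime-divisor (prime∤⇒coprime pr p∤d) d∣p^[1+n])
... | yes (divides q refl) with ∣p^n⇒≡p^x pr n q∣p^n
  where
  instance _ = prime⇒nonZero pr
  q∣p^n : q ℕ.∣ p ^ n
  q∣p^n = ℕ.*-cancelˡ-∣ p (subst (ℕ._∣ p ^ suc n) (ℕ.*-comm q p) d∣p^[1+n])
...   | x , refl = suc x , ℕ.*-comm (p ^ x) p

alternatingSum : ∀ {m} → Vec ℕ m → ℤ
alternatingSum []       = 0ℤ
alternatingSum (c ∷ cs) = + c ℤ.- alternatingSum cs

alternatingSum-∷ʳ : ∀ {m} (cs : Vec ℕ m) c →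
  alternatingSum (cs ∷ʳ c) ≡ alternatingSum cs ℤ.+ -1ℤ ℤ.^ m ℤ.* + c
alternatingSum-∷ʳ []       c = begin
  + c ℤ.+ 0ℤ              ≡⟨ ℤ.+-identityʳ (+ c) ⟩
  + c                     ≡⟨ ℤ.*-identityˡ (+ c) ⟨
  1ℤ ℤ.* + c              ≡⟨ ℤ.+-identityˡ (1ℤ ℤ.* + c) ⟨
  0ℤ ℤ.+ 1ℤ ℤ.* + c       ∎
  where open ≡-Reasoning
alternatingSum-∷ʳ {suc m} (d ∷ cs) c = begin
  + d ℤ.- alternatingSum (cs ∷ʳ c)
    ≡⟨ cong (λ s → + d ℤ.- s) (alternatingSum-∷ʳ cs c) ⟩
  + d ℤ.- (alternatingSum cs ℤ.+ -1ℤ ℤ.^ m ℤ.* + c)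
    ≡⟨ regroup (+ d) (alternatingSum cs) (-1ℤ ℤ.^ m) (+ c) ⟩
  (+ d ℤ.- alternatingSum cs) ℤ.+ -1ℤ ℤ.* -1ℤ ℤ.^ m ℤ.* + c
    ∎
  where
  open ≡-Reasoning
  regroup : ∀ d a s c → d ℤ.- (a ℤ.+ s ℤ.* c) ≡ (d ℤ.- a) ℤ.+ -1ℤ ℤ.* s ℤ.* c
  regroup = solve-∀

alternatingSum-reverse : ∀ {m} (cs : Vec ℕ m) →
  alternatingSum (reverse cs) ≡ -1ℤ ℤ.^ suc m ℤ.* alternatingSum cs
alternatingSum-reverse []       = refl
alternatingSum-reverse {suc m} (c ∷ cs) = begin
  alternatingSum (reverse (c ∷ cs))
    ≡⟨ cong alternatingSum (reverse-∷ c cs) ⟩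
  alternatingSum (reverse cs ∷ʳ c)
    ≡⟨ alternatingSum-∷ʳ (reverse cs) c ⟩
  alternatingSum (reverse cs) ℤ.+ -1ℤ ℤ.^ m ℤ.* + c
    ≡⟨ cong (ℤ._+ -1ℤ ℤ.^ m ℤ.* + c) (alternatingSum-reverse cs) ⟩
  -1ℤ ℤ.* -1ℤ ℤ.^ m ℤ.* alternatingSum cs ℤ.+ -1ℤ ℤ.^ m ℤ.* + c
    ≡⟨ regroup (-1ℤ ℤ.^ m) (alternatingSum cs) (+ c) ⟩
  -1ℤ ℤ.* (-1ℤ ℤ.* -1ℤ ℤ.^ m) ℤ.* (+ c ℤ.- alternatingSum cs)
    ∎
  where
  open ≡-Reasoning
  regroup : ∀ s a c → -1ℤ ℤ.* s ℤ.* a ℤ.+ s ℤ.* c ≡ -1ℤ ℤ.* (-1ℤ ℤ.* s) ℤ.* (c ℤ.- a)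
  regroup = solve-∀

-1^[2*j]≡1 : ∀ j → -1ℤ ℤ.^ (2 * j) ≡ 1ℤ
-1^[2*j]≡1 j = trans (sym (ℤ.^-*-assoc -1ℤ 2 j)) (ℤ.^-zeroˡ j)

i≡-i⇒i≡0 : ∀ {i} → i ≡ - i → i ≡ 0ℤ
i≡-i⇒i≡0 { + zero }   _  = refl
i≡-i⇒i≡0 { +[1+ _ ] } ()
i≡-i⇒i≡0 { -[1+ _ ] } ()

even-palindrome⇒alternatingSum≡0 : ∀ {m} (cs : Vec ℕ m) → IsPalindrome cs →
  ∃[ j ] m ≡ 2 * j → alternatingSum cs ≡ 0ℤ
even-palindrome⇒alternatingSum≡0 {m} cs pal (j , refl) = i≡-i⇒i≡0 (begin
  alternatingSum cs
    ≡⟨ cong alternatingSum pal ⟨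
  alternatingSum (reverse cs)
    ≡⟨ alternatingSum-reverse cs ⟩
  -1ℤ ℤ.* -1ℤ ℤ.^ m ℤ.* alternatingSum cs
    ≡⟨ cong (λ s → -1ℤ ℤ.* s ℤ.* alternatingSum cs) (-1^[2*j]≡1 j) ⟩
  -1ℤ ℤ.* alternatingSum cs
    ≡⟨ ℤ.-1*i≡-i (alternatingSum cs) ⟩
  - alternatingSum cs
    ∎)
  where open ≡-Reasoning

value≡alternatingSum[mod1+b] : ∀ {m} b (cs : Vec ℕ m) →
  + suc b ℤ.∣ + value b cs ℤ.- alternatingSum cs
value≡alternatingSum[mod1+b] b []       = ℤ.divides 0ℤ refl
value≡alternatingSum[mod1+b] b (c ∷ cs) = begin
  + suc b
    ∣⟨ ∣m∣n⇒∣m+n (∣n⇒∣m*n (+ b) (value≡alternatingSum[mod1+b] b cs))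
                 (∣m⇒∣m*n (alternatingSum cs) ∣-refl) ⟩
  + b ℤ.* (+ value b cs ℤ.- alternatingSum cs) ℤ.+ + suc b ℤ.* alternatingSum cs
    ≡⟨ regroup (+ c) (+ b) (+ value b cs) (alternatingSum cs) ⟨
  + c ℤ.+ + b ℤ.* + value b cs ℤ.- (+ c ℤ.- alternatingSum cs)
    ≡⟨ cong (λ v → v ℤ.- (+ c ℤ.- alternatingSum cs)) value-∷ ⟨
  + value b (c ∷ cs) ℤ.- alternatingSum (c ∷ cs)
    ∎
  where
  open ∣-Reasoning
  value-∷ : + value b (c ∷ cs) ≡ + c ℤ.+ + b ℤ.* + value b cs
  value-∷ = trans (ℤ.pos-+ c (b * value b cs))
                  (cong (λ v → + c ℤ.+ v) (ℤ.pos-* b (value b cs)))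
  regroup : ∀ c b v a → c ℤ.+ b ℤ.* v ℤ.- (c ℤ.- a) ≡ b ℤ.* (v ℤ.- a) ℤ.+ (1ℤ ℤ.+ b) ℤ.* a
  regroup = solve-∀

1+b∣even-palindrome : ∀ {m} b (cs : Vec ℕ m) → IsPalindrome cs →
  ∃[ j ] m ≡ 2 * j → suc b ℕ.∣ value b cs
1+b∣even-palindrome b cs pal m-even = ∣⇒∣ᵤ (subst (+ suc b ℤ.∣_) value-0≡value
  (value≡alternatingSum[mod1+b] b cs))
  where
  value-0≡value : + value b cs ℤ.- alternatingSum cs ≡ + value b cs
  value-0≡value = trans
    (cong (λ a → + value b cs ℤ.- a) (even-palindrome⇒alternatingSum≡0 cs pal m-even))
    (ℤ.+-identityʳ (+ value b cs))

theorem3p1 : (p n b k : ℕ) → Prime p → 0 < n → 1 < b →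
    (cs : Vec ℕ (suc k)) → IsBaseRep b (p ^ n) k cs → IsPalindrome cs →
    (∃[ j ] k ≡ suc (2 * j)) →
    ∃[ x ] b ≡ p ^ x ∸ 1
theorem3p1 p n b k pr _ _ cs (_ , _ , value≡p^n) pal (j , refl) =
  map₂ (cong (_∸ 1)) (∣p^n⇒≡p^x pr n 1+b∣p^n)
  where
  1+b∣p^n : suc b ℕ.∣ p ^ n
  1+b∣p^n = subst (suc b ℕ.∣_) value≡p^n
    (1+b∣even-palindrome b cs pal (suc j , sym (ℕ.*-distribˡ-+ 2 1 j)))
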